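{- For all names $P,Q$: if $\eta\,P\,(\mathit{sat\_InteriorPoint}\,Q)$, then $\neg\,\eta\,P\,(\partial\,Q)$.
   Context: Setting: a Coq formalization (classical logic) of Leśniewski's Ontology and Mereology extended with Tarski's geometry of solids. Names form a type $N$ with a primitive relation $\eta:N\to N\to\mathrm{Prop}$ satisfying Leśniewski's ontological axiom $\eta\,A\,b \leftrightarrow ((\exists C,\eta\,C\,A)\wedge(\forall C\,D,\eta\,C\,A\wedge\eta\,D\,A\to\eta\,C\,D)\wedge(\forall C,\eta\,C\,A\to\eta\,C\,b))$; $A$ is an individual iff $\eta\,A\,A$; $a\subseteq b$ means $\forall P,\eta\,P\,a\to\eta\,P\,b$; $P\equiv Q$ means $\eta\,P\,Q\wedge\eta\,Q\,P$. Mereology: $pt:N\to N$ ($\eta\,B\,(pt\,A)$: $B$ is a part of $A$) satisfying Leśniewski's mereology axioms (part-of a partial order on individuals; every non-empty name has a unique m-class). M-class: $\eta\,A\,(klass\,a)$ iff $\eta\,A\,A$, $\forall B,\eta\,B\,a\to\eta\,B\,(pt\,A)$, and $\forall B,\eta\,B\,(pt\,A)\to\exists C\,D,\eta\,C\,a\wedge\eta\,D\,(pt\,C)\wedge\eta\,D\,(pt\,B)$. $\eta\,P\,(ext\,Q)$ iff $P,Q$ are individuals with no common part ("exterior"). Geometry: $\mathit{balls}$ is a primitive name (there exists at least one ball). Tarski's definitions for balls: $A$ is externally tangent to $B$ iff $A$ is exterior to $B$ and for any balls $X,Y$ both having $A$ as part and both exterior to $B$, one of $X,Y$ is part of the other;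 $A$ is internally tangent to $B$ iff $A$ is a proper part of $B$ and for any balls $X,Y$ both having $A$ as a part and both parts of $B$, one of $X,Y$ is part of the other; $A,B$ are externally diametrical w.r.t. $C$ iff both are externally tangent to $C$ and for any balls $X,Y$ exterior to $C$ with $A$ part of $X$ and $B$ part of $Y$, $X$ is exterior to $Y$; $A,B$ are internally diametrical w.r.t. $C$ iff both are internally tangent to $C$ and for any balls $X,Y$ externally tangent to $C$ with $A$ exterior to $X$ and $B$ exterior to $Y$, $X$ is exterior to $Y$; $A$ is concentric with $B$ iff $A=B$, or $A$ is a proper part of $B$ and any balls $X,Y$ externally diametrical w.r.t. $A$ and internally tangent to $B$ are internally diametrical w.r.t. $B$, or the same holds with $A,B$ interchanged. $\eta\,P\,(\mathit{Concent}\,Q)$ iff $P,Q$ are balls and $P$ is concentric with $Q$. Point: $\eta\,P\,(\mathit{Point}\,Q)$ iff $\eta\,P\,\mathit{balls}\wedge\eta\,Q\,\mathit{balls}\wedge\eta\,P\,(\mathit{Concent}\,Q)$. Region: $\eta\,P\,\mathit{Region}$ iff $\eta\,P\,P$ and $\exists b,\ b\subseteq\mathit{balls}\wedge\eta\,P\,(klass\,b)$. Saturated interior point: $\eta\,P\,(\mathit{sat\_InteriorPoint}\,Q)$ iff $\eta\,Q\,\mathit{Region}$ and $\exists P',\ \eta\,P\,(\mathit{Point}\,P')\wedge\eta\,P'\,(pt\,Q)\wedge(\eta\,P'\,(pt\,P)\to P\equiv P')$. Boundary: $\eta\,P\,(\partial\,Q)$ iff $\eta\,Q\,\mathit{Region}$,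 $\eta\,P\,\mathit{balls}$, and $\forall Y,\ (\eta\,Y\,\mathit{balls}\wedge\eta\,P\,(\mathit{Point}\,Y))\to(\neg\eta\,Y\,(pt\,Q)\wedge\neg\eta\,Y\,(ext\,Q))$. -}

module Defs where

open import Data.Product using (Σ; ∃; ∃-syntax; _×_; _,_)
open import Data.Sum using (_⊎_)
open import Data.Empty using (⊥)
open import Relation.Nullary using (¬_)

-- Leśniewski's Ontology: a type of names with the primitive η and the
-- ontological axiom.
record Ontology : Set₁ where
  field
    N : Set
    η : N → N → Set
    ontAx : ∀ A b → (η A b → (∃[ C ] η C A) × (∀ C D → η C A → η D A → η C D) × (∀ C → η C A → η C b))
                  × ((∃[ C ] η C A) × (∀ C D → η C A → η D A → η C D) × (∀ C → η C A → η C b) → η A b)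
    lem : (X : Set) → X ⊎ ¬ X

module OntologyDefs (O : Ontology) where
  open Ontology O public

  individual : N → Set
  individual A = η A A

  _⊆_ : N → N → Set
  a ⊆ b = ∀ P → η P a → η P b

  _≡ₙ_ : N → N → Set
  P ≡ₙ Q = η P Q × η Q P

  -- membership in the m-class of a, given the part-of name constructor pt
  IsKlass : (N → N) → N → N → Set
  IsKlass pt a A = η A A × (∀ B → η B a → η B (pt A))
                 × (∀ B → η B (pt A) → ∃[ C ] ∃[ D ] (η C a × η D (pt C) × η D (pt B)))

record Mereology : Set₁ where
  field
    ont : Ontology
  open OntologyDefs ont
  field
    pt : N → N
    pt-ind   : ∀ A B → η B (pt A) → η B B × η A A
    pt-refl  : ∀ A → η A A → η A (pt A)
    pt-antisym : ∀ A B → η A (pt B) → η B (pt A) → A ≡ₙ B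
    pt-trans : ∀ A B C → η A (pt B) → η B (pt C) → η A (pt C)
    klass-exists : ∀ a → (∃[ C ] η C a) → ∃[ A ] IsKlass pt a A
    klass-unique : ∀ a A B → IsKlass pt a A → IsKlass pt a B → η A B

-- Tarski's geometry of solids: a primitive name `balls`, nonempty.
record Geometry : Set₁ where
  field
    mer : Mereology
  open Mereology mer
  open OntologyDefs ont
  field
    balls : N
    balls-nonempty : ∃[ B ] η B balls

module GeometryDefs (G : Geometry) where
  open Geometry G public
  open Mereology mer public
  open OntologyDefs ont public

  ball : N → Set
  ball X = η X balls

  klass : N → N → Set   -- η A (klass a)
  klass a A = IsKlass pt a A

  -- η P (ext Q): P, Q individuals with no common part
  ext : N → N → Set
  ext P Q = η P P × η Q Q × ¬ (∃[ C ] (η C (pt P) × η C (pt Q)))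

  properPart : N → N → Set
  properPart A B = η A (pt B) × ¬ (A ≡ₙ B)

  extTangent : N → N → Set
  extTangent A B = ball A × ball B × ext A B ×
    (∀ X Y → ball X → ball Y → η A (pt X) → η A (pt Y) → ext X B → ext Y B →
       η X (pt Y) ⊎ η Y (pt X))

  intTangent : N → N → Set
  intTangent A B = ball A × ball B × properPart A B ×
    (∀ X Y → ball X → ball Y → η A (pt X) → η A (pt Y) → η X (pt B) → η Y (pt B) →
       η X (pt Y) ⊎ η Y (pt X))

  extDiam : N → N → N → Set
  extDiam A B C = extTangent A C × extTangent B C ×
    (∀ X Y → ball X → ball Y → ext X C → ext Y C → η A (pt X) → η B (pt Y) → ext X Y)

  intDiam : N → N → N → Set
  intDiam A B C = intTangent A C × intTangent B C ×
    (∀ X Y → ball X → ball Y → extTangent X C → extTangent Y C → ext A X → ext B Y → ext X Y)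

  concentricStep : N → N → Set
  concentricStep A B = properPart A B ×
    (∀ X Y → ball X → ball Y → extDiam X Y A → intTangent X B → intTangent Y B → intDiam X Y B)

  concentric : N → N → Set
  concentric A B = (A ≡ₙ B) ⊎ concentricStep A B ⊎ concentricStep B A

  -- η P (Concent Q)
  Concent : N → N → Set
  Concent P Q = ball P × ball Q × concentric P Q

  -- η P (Point Q)
  Point : N → N → Set
  Point P Q = ball P × ball Q × Concent P Q

  -- η P Region
  Region : N → Set
  Region P = η P P × ∃[ b ] (b ⊆ balls × klass b P)

  -- η P (sat_InteriorPoint Q)
  satInteriorPoint : N → N → Set
  satInteriorPoint P Q = Region Q ×
    ∃[ P' ] (Point P P' × η P' (pt Q) × (η P' (pt P) → P ≡ₙ P'))

  -- η P (∂ Q)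
  boundary : N → N → Set
  boundary P Q = Region Q × ball P ×
    (∀ Y → ball Y × Point P Y → ¬ η Y (pt Q) × ¬ ext Y Q)

{-# OPTIONS --safe #-}
module Submission where

open import Defs
open import Relation.Nullary using (¬_)
open import Data.Product using (_,_; proj₁)

module _ (G : Geometry) where
  open GeometryDefs G

  boundary⇒Point-¬part : ∀ {P Q Y} → boundary P Q → Point P Y → ¬ η Y (pt Q)
  boundary⇒Point-¬part (_ , _ , notPartNorExt) P-Point-Y@(_ , ball-Y , _) =
    proj₁ (notPartNorExt _ (ball-Y , P-Point-Y))

lemma9 : (G : Geometry) → let open GeometryDefs G in
    ∀ P Q → satInteriorPoint P Q → ¬ boundary P Q
lemma9 G P Q (_ , _ , P-Point-P' , P'-part-Q , _) P-boundary-Q =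
  boundary⇒Point-¬part G P-boundary-Q P-Point-P' P'-part-Q
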